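{- Let $p\ge3$ be an integer, $u$ an integer coprime to $p$, and $r_1$ the integer with $0<r_1<p$ and $ur_1\equiv1\pmod p$. Let $D$ be the set of integer pairs $(a,b)$, $a<b$, with $\max(\langle ua\rangle_p,\langle ub\rangle_p)<\min_{a<n<b}\langle un\rangle_p$, and let $D'$ be the set of integer pairs $(a,b)$, $a<b$, with $\min(\langle ua\rangle_p,\langle ub\rangle_p)>\max_{a<n<b}\langle un\rangle_p$ (both conditions vacuous when $b=a+1$). Then the involution $(x,y)\mapsto(-r_1-y,-r_1-x)$ maps $D$ bijectively onto $D'$ and $D'$ bijectively onto $D$; consequently $$\{b-a : (a,b)\in D\}=\{b-a : (a,b)\in D'\}.$$
   Context: $\langle x\rangle_p$ denotes the least nonnegative residue of the integer $x$ modulo $p$. -}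

module Defs where

open import Data.Nat as ℕ using (ℕ; NonZero)
open import Data.Integer using (ℤ; _+_; _*_; -_; _-_; _<_; _%ℕ_)
open import Data.Product using (_×_; _,_)

⟨_⟩[_] : ℤ → (p : ℕ) → .{{NonZero p}} → ℕ
⟨ x ⟩[ p ] = x %ℕ p

-- (a , b) ∈ D :  a < b  and  max(⟨ua⟩,⟨ub⟩) < min_{a<n<b} ⟨un⟩
-- (the max is below the min iff each of ⟨ua⟩,⟨ub⟩ is below every ⟨un⟩, a<n<b;
--  vacuous when b = a + 1)
InD : (p : ℕ) .{{_ : NonZero p}} → ℤ → ℤ → ℤ → Set
InD p u a b = a < b × (∀ n → a < n → n < b →
  (⟨ u * a ⟩[ p ] ℕ.< ⟨ u * n ⟩[ p ]) × (⟨ u * b ⟩[ p ] ℕ.< ⟨ u * n ⟩[ p ]))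

InD' : (p : ℕ) .{{_ : NonZero p}} → ℤ → ℤ → ℤ → Set
InD' p u a b = a < b × (∀ n → a < n → n < b →
  (⟨ u * n ⟩[ p ] ℕ.< ⟨ u * a ⟩[ p ]) × (⟨ u * n ⟩[ p ] ℕ.< ⟨ u * b ⟩[ p ]))

σ : ℤ → ℤ × ℤ → ℤ × ℤ
σ r₁ (x , y) = (- r₁ - y , - r₁ - x)

{-# OPTIONS --safe #-}
module Submission where

-- Since u r₁ ≡ 1 (mod p), u (-r₁ - z) ≡ -1 - u z, hence ⟨u (-r₁ - z)⟩ = p - 1 - ⟨u z⟩: the
-- reflection z ↦ -r₁ - z reverses both the order of ℤ and the order of the residues ⟨u ·⟩.
-- It therefore exchanges intervals whose endpoint residues lie below all interior ones with
-- those whose endpoint residues lie above them, and preserves the width b - a.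
-- Only u r₁ ≡ 1 (mod p) is used.

open import Defs
open import Data.Nat as ℕ using (ℕ; NonZero)
open import Data.Nat.Coprimality using (Coprime)
open import Data.Integer using (ℤ; +_; _+_; _*_; -_; _-_; _<_; ∣_∣; 1ℤ)
open import Data.Integer.Divisibility using (_∣_)
open import Data.Product using (_×_; _,_; ∃-syntax)
open import Relation.Binary.PropositionalEquality using (_≡_)
open import Function.Bundles using (_⇔_)

open import Data.Integer using (_/ℕ_)
open import Data.Nat.DivMod using (m<n⇒m%n≡m)
open import Data.Nat.Divisibility using (n∣m⇒m%n≡0)
import Data.Nat.Properties as ℕₚ
open import Data.Integer.DivMod using (a≡a%ℕn+[a/ℕn]*n; n%ℕd<d)
import Data.Integer.Properties as ℤₚ
open import Data.Integer.Divisibility.Signed as Signed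
  using (divides; ∣⇒∣ᵤ; ∣ᵤ⇒∣; ∣-refl; ∣m⇒∣-m; ∣m∣n⇒∣m+n; ∣m∣n⇒∣m-n)
open import Data.Integer.Tactic.RingSolver using (solve-∀)
open import Function.Base using (flip)
open import Function.Bundles using (mk⇔)
open import Relation.Binary.PropositionalEquality
  using (sym; trans; cong; cong₂; subst; subst₂; module ≡-Reasoning)

residue-unique : ∀ p .{{_ : NonZero p}} {r s} → r ℕ.< p → s ℕ.< p → + p ∣ + r - + s → r ≡ s
residue-unique p {r} {s} r<p s<p p∣r-s =
  ℤₚ.+-injective (ℤₚ.i-j≡0⇒i≡j (+ r) (+ s) (ℤₚ.∣i∣≡0⇒i≡0 ∣r-s∣≡0))
  where
  ∣r-s∣<p : ∣ + r - + s ∣ ℕ.< p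
  ∣r-s∣<p = subst (ℕ._< p) (cong ∣_∣ (sym (ℤₚ.m-n≡m⊖n r s)))
              (ℕₚ.≤-<-trans (ℤₚ.∣m⊝n∣≤m⊔n r s) (ℕₚ.⊔-lub r<p s<p))
  ∣r-s∣≡0 : ∣ + r - + s ∣ ≡ 0
  ∣r-s∣≡0 = trans (sym (m<n⇒m%n≡m ∣r-s∣<p)) (n∣m⇒m%n≡0 _ p p∣r-s)

p∣x-⟨x⟩ : ∀ p .{{_ : NonZero p}} x → + p Signed.∣ x - + ⟨ x ⟩[ p ]
p∣x-⟨x⟩ p x = divides (x /ℕ p) (begin
  x - + r                    ≡⟨ cong (_- + r) (a≡a%ℕn+[a/ℕn]*n x p) ⟩
  (+ r + x /ℕ p * + p) - + r ≡⟨ +-minus (+ r) (x /ℕ p * + p) ⟩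
  x /ℕ p * + p               ∎)
  where
  open ≡-Reasoning
  r : ℕ
  r = ⟨ x ⟩[ p ]
  +-minus : ∀ a b → (a + b) - a ≡ b
  +-minus = solve-∀

⟨⟩-cong : ∀ p .{{_ : NonZero p}} x y → + p Signed.∣ x - y → ⟨ x ⟩[ p ] ≡ ⟨ y ⟩[ p ]
⟨⟩-cong p x y p∣x-y = residue-unique p (n%ℕd<d x p) (n%ℕd<d y p)
  (∣⇒∣ᵤ (subst (+ p Signed.∣_) (telescope x y (+ ⟨ x ⟩[ p ]) (+ ⟨ y ⟩[ p ])) p∣⟨x⟩-⟨y⟩))
  where
  p∣⟨x⟩-⟨y⟩ : + p Signed.∣ ((x - y) - (x - + ⟨ x ⟩[ p ])) + (y - + ⟨ y ⟩[ p ])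
  p∣⟨x⟩-⟨y⟩ = ∣m∣n⇒∣m+n (∣m∣n⇒∣m-n p∣x-y (p∣x-⟨x⟩ p x)) (p∣x-⟨x⟩ p y)
  telescope : ∀ x y r s → ((x - y) - (x - r)) + (y - s) ≡ r - s
  telescope = solve-∀

⟨-1-x⟩≡p∸1+⟨x⟩ : ∀ p .{{_ : NonZero p}} x → ⟨ - 1ℤ - x ⟩[ p ] ≡ p ℕ.∸ ℕ.suc ⟨ x ⟩[ p ]
⟨-1-x⟩≡p∸1+⟨x⟩ p x = trans (⟨⟩-cong p (- 1ℤ - x) (+ (p ℕ.∸ ℕ.suc w)) p∣difference)
                            (m<n⇒m%n≡m (ℕₚ.∸-monoʳ-< ℕ.z<s w<p))
  where
  w : ℕ
  w = ⟨ x ⟩[ p ]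
  w<p : w ℕ.< p
  w<p = n%ℕd<d x p
  p∸1+w≡p-1-w : + (p ℕ.∸ ℕ.suc w) ≡ + p - (1ℤ + + w)
  p∸1+w≡p-1-w = sym (trans (ℤₚ.m-n≡m⊖n p (ℕ.suc w)) (ℤₚ.⊖-≥ w<p))
  complement : ∀ x w p → - (x - w) + - p ≡ (- 1ℤ - x) - (p - (1ℤ + w))
  complement = solve-∀
  p∣difference : + p Signed.∣ (- 1ℤ - x) - + (p ℕ.∸ ℕ.suc w)
  p∣difference = subst (λ t → + p Signed.∣ (- 1ℤ - x) - t) (sym p∸1+w≡p-1-w)
    (subst (+ p Signed.∣_) (complement x (+ w) (+ p))
      (∣m∣n⇒∣m+n (∣m⇒∣-m (p∣x-⟨x⟩ p x)) (∣m⇒∣-m ∣-refl)))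

⟨u[-r-z]⟩≡p∸1+⟨uz⟩ : ∀ p .{{_ : NonZero p}} u r → + p Signed.∣ u * r - 1ℤ →
                     ∀ z → ⟨ u * (- r - z) ⟩[ p ] ≡ p ℕ.∸ ℕ.suc ⟨ u * z ⟩[ p ]
⟨u[-r-z]⟩≡p∸1+⟨uz⟩ p u r p∣ur-1 z =
  trans (⟨⟩-cong p (u * (- r - z)) (- 1ℤ - u * z)
           (subst (+ p Signed.∣_) (shift u r z) (∣m⇒∣-m p∣ur-1)))
        (⟨-1-x⟩≡p∸1+⟨x⟩ p (u * z))
  where
  shift : ∀ u r z → - (u * r - 1ℤ) ≡ u * (- r - z) - (- 1ℤ - u * z)
  shift = solve-∀

reflection-reverses-residues : ∀ p .{{_ : NonZero p}} u r → + p Signed.∣ u * r - 1ℤ → ∀ {z z'} →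
  ⟨ u * z ⟩[ p ] ℕ.< ⟨ u * z' ⟩[ p ] → ⟨ u * (- r - z') ⟩[ p ] ℕ.< ⟨ u * (- r - z) ⟩[ p ]
reflection-reverses-residues p u r p∣ur-1 {z} {z'} lt =
  subst₂ ℕ._<_ (sym (reflect z')) (sym (reflect z)) (ℕₚ.∸-monoʳ-< (ℕ.s≤s lt) (n%ℕd<d (u * z') p))
  where
  reflect : ∀ z → ⟨ u * (- r - z) ⟩[ p ] ≡ p ℕ.∸ ℕ.suc ⟨ u * z ⟩[ p ]
  reflect = ⟨u[-r-z]⟩≡p∸1+⟨uz⟩ p u r p∣ur-1

i-[i-j]≡j : ∀ c x → c - (c - x) ≡ x
i-[i-j]≡j = solve-∀

[i-j]-[i-k]≡k-j : ∀ c a b → (c - a) - (c - b) ≡ b - a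
[i-j]-[i-k]≡k-j = solve-∀

i-‿antimono-< : ∀ c {a b} → a < b → c - b < c - a
i-‿antimono-< c a<b = ℤₚ.+-monoʳ-< c (ℤₚ.neg-mono-< a<b)

EndpointsBound : (ℤ → ℤ → Set) → ℤ → ℤ → Set
EndpointsBound R a b = a < b × (∀ n → a < n → n < b → R a n × R b n)

reflect-EndpointsBound : ∀ c {R S : ℤ → ℤ → Set} → (∀ {e n} → R e n → S (c - e) (c - n)) →
  ∀ {a b} → EndpointsBound R a b → EndpointsBound S (c - b) (c - a)
reflect-EndpointsBound c {S = S} R⇒S {a} {b} (a<b , interior) =
  i-‿antimono-< c a<b , λ n c-b<n n<c-a →
    let a<c-n = subst (_< c - n) (i-[i-j]≡j c a) (i-‿antimono-< c n<c-a)
        c-n<b = subst (c - n <_) (i-[i-j]≡j c b) (i-‿antimono-< c c-b<n)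
        (Rac-n , Rbc-n) = interior (c - n) a<c-n c-n<b
    in subst (S (c - b)) (i-[i-j]≡j c n) (R⇒S Rbc-n) ,
       subst (S (c - a)) (i-[i-j]≡j c n) (R⇒S Rac-n)

reflect-∃-width : ∀ c {P Q : ℤ → ℤ → Set} → (∀ x y → P x y → Q (c - y) (c - x)) →
  ∀ {d} → ∃[ a ] ∃[ b ] (P a b × b - a ≡ d) → ∃[ a ] ∃[ b ] (Q a b × b - a ≡ d)
reflect-∃-width c P⇒Q (a , b , Pab , b-a≡d) =
  c - b , c - a , P⇒Q a b Pab , trans ([i-j]-[i-k]≡k-j c a b) b-a≡d

lemma1 : (p : ℕ) .{{_ : NonZero p}} → 3 ℕ.≤ p →
    (u : ℤ) → Coprime ∣ u ∣ p →
    (r₁ : ℤ) → + 0 < r₁ → r₁ < + p → (+ p) ∣ (u * r₁ - 1ℤ) →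
    ((∀ x y → σ r₁ (σ r₁ (x , y)) ≡ (x , y))
    × (∀ x y → InD p u x y → InD' p u (- r₁ - y) (- r₁ - x))
    × (∀ x y → InD' p u x y → InD p u (- r₁ - y) (- r₁ - x)))
    × (∀ d → (∃[ a ] ∃[ b ] (InD p u a b × b - a ≡ d)) ⇔ (∃[ a ] ∃[ b ] (InD' p u a b × b - a ≡ d)))
lemma1 p _ u _ r₁ _ _ p∣ur₁-1 =
  ((λ x y → cong₂ _,_ (i-[i-j]≡j (- r₁) x) (i-[i-j]≡j (- r₁) y)) , InD⇒InD' , InD'⇒InD) ,
  λ d → mk⇔ (reflect-∃-width (- r₁) InD⇒InD') (reflect-∃-width (- r₁) InD'⇒InD)
  where
  reverses : ∀ {z z'} → ⟨ u * z ⟩[ p ] ℕ.< ⟨ u * z' ⟩[ p ] →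
             ⟨ u * (- r₁ - z') ⟩[ p ] ℕ.< ⟨ u * (- r₁ - z) ⟩[ p ]
  reverses = reflection-reverses-residues p u r₁ (∣ᵤ⇒∣ p∣ur₁-1)
  -- InD p u and InD' p u unfold to EndpointsBound _◁_ and EndpointsBound (flip _◁_).
  _◁_ : ℤ → ℤ → Set
  e ◁ n = ⟨ u * e ⟩[ p ] ℕ.< ⟨ u * n ⟩[ p ]
  InD⇒InD' : ∀ x y → InD p u x y → InD' p u (- r₁ - y) (- r₁ - x)
  InD⇒InD' x y = reflect-EndpointsBound (- r₁) {_◁_} {flip _◁_} reverses
  InD'⇒InD : ∀ x y → InD' p u x y → InD p u (- r₁ - y) (- r₁ - x)
  InD'⇒InD x y = reflect-EndpointsBound (- r₁) {flip _◁_} {_◁_} reverses
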